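{- Let $G=(V,E)\in\mathfrak{Gr}(n,k,\ell)$ with $n>k$ and $\ell\ge 2$. Then: (i) for all $x\in V$, $\ell+1<n-k+\ell+1\le|N[x]|\le k-\ell$; in other words, the minimum degree of $G$ is at least $n-k+\ell$ and the maximum degree is at most $k-\ell-1$; (ii) for all distinct $x,y\in V$, $|N[x]\cap N[y]|\le k-2\ell+1$; (iii) $n\le 2k-2\ell-1$ and $k\ge 2\ell+2$.
   Context: All graphs are finite, simple and undirected. For a graph $G=(V,E)$ and $x\in V$, $N[x]=\{x\}\cup\{y: xy\in E\}$; for $X\subseteq V$, $N[X]=\bigcup_{x\in X}N[x]$ (so $N[\emptyset]=\emptyset$). A set $C\subseteq V$ is $(1,\le\ell)$-identifying if $N[X]\cap C\neq N[Y]\cap C$ for all distinct $X,Y\subseteq V$ with $|X|\le\ell$, $|Y|\le\ell$. For $n\ge k\ge1$ and $\ell\ge1$, $\mathfrak{Gr}(n,k,\ell)$ is the set of graphs on $n$ vertices in which every $k$-element subset of vertices is $(1,\le\ell)$-identifying. -}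

module Defs where

open import Data.Nat using (ℕ; _≤_)
open import Data.Bool using (Bool; true; false; _∨_; if_then_else_)
open import Data.Fin using (Fin; _≟_)
open import Data.Fin.Subset using (Subset; ⋃; ⊥; _∩_; ∣_∣)
open import Data.List using (map; allFin)
open import Data.Vec using (tabulate; lookup)
open import Relation.Nullary using (¬_)
open import Relation.Nullary.Decidable using (⌊_⌋)
open import Relation.Binary.PropositionalEquality using (_≡_; _≢_)

record Graph (n : ℕ) : Set where
  field
    adj    : Fin n → Fin n → Bool
    sym    : ∀ x y → adj x y ≡ adj y x
    irrefl : ∀ x → adj x x ≡ false
open Graph public

N[_∣_] : ∀ {n} → Graph n → Fin n → Subset n
N[ G ∣ x ] = tabulate (λ y → ⌊ x ≟ y ⌋ ∨ adj G x y)

NS[_∣_] : ∀ {n} → Graph n → Subset n → Subset n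
NS[_∣_] {n} G X = ⋃ (map (λ x → if lookup X x then N[ G ∣ x ] else ⊥) (allFin n))

Identifying : ∀ {n} → Graph n → ℕ → Subset n → Set
Identifying {n} G ℓ C =
  ∀ (X Y : Subset n) → ∣ X ∣ ≤ ℓ → ∣ Y ∣ ≤ ℓ → X ≢ Y →
  NS[ G ∣ X ] ∩ C ≢ NS[ G ∣ Y ] ∩ C

InGr : ∀ {n} → Graph n → ℕ → ℕ → Set
InGr {n} G k ℓ = ∀ (C : Subset n) → ∣ C ∣ ≡ k → Identifying G ℓ C

-- For distinct x, y let A be the part of a k-set C lying in N[x] ∖ N[y]. Then {x, y} ∪ A and
-- {y} ∪ A have the same trace on C, so ℓ ≤ |A| + 1; choosing C to meet N[x] ∖ N[y] as little as
-- possible gives |N[x] ∖ N[y]| ≥ n − k + ℓ − 1. Hence every vertex x has a neighbour z, and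
-- N[x] ∩ N[z] ⊇ {x, z} yields the lower degree bound. For the upper bound, a k-set C inside N[x]
-- is dominated by both {x} and {x, z}, so take C ⊋ N[x]; for a ∈ A = C ∖ N[x] with a neighbour z,
-- the sets {x} ∪ A and {x, z} ∪ (A ∖ {a}) both dominate C, forcing |A| ≥ ℓ.
module Submission where

open import Defs hiding (sym)
open import Data.Nat using (ℕ; zero; suc; _+_; _*_; _∸_; _≤_; _<_; _≤?_; _<?_; z≤n; s≤s)
open import Data.Nat.Properties
  using ( +-suc; +-assoc; +-comm; +-identityʳ; ≤-reflexive; ≤-trans; ≤-antisym; ≤-pred; n≤1+n; m≤n+m
        ; <⇒≤; <⇒≱; ≰⇒>; ≮⇒≥; m<n⇒0<n∸m; m∸n+n≡m
        ; +-monoˡ-≤; +-monoʳ-≤; +-cancelˡ-≤; +-cancelʳ-≤; +-cancelˡ-<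
        ; module ≤-Reasoning )
open import Data.Nat.Tactic.RingSolver using (solve-∀)
open import Data.Bool using (Bool; true; false; _∨_; if_then_else_)
open import Data.Bool.Properties using (∨-zeroʳ)
open import Data.Fin using (Fin; zero; suc; _≟_; fromℕ<)
open import Data.Fin.Subset
  using ( Subset; inside; outside; ⋃; ⊥; ⊤; ∁; ⁅_⁆; _∩_; _∪_; _─_; _-_; ∣_∣
        ; _∈_; _∉_; _⊆_; Nonempty; Empty )
open import Data.Fin.Subset.Properties
  using ( _∈?_; ∉⊥; Empty-unique; ⊆⊤; ∣⊥∣≡0; ∣⊤∣≡n; x∈⁅x⁆; x∈⁅y⁆⇒x≡y; x≢y⇒x∉⁅y⁆; x∉⁅y⁆⇒x≢y; ∣⁅x⁆∣≡1
        ; ⊆-refl; ⊆-antisym; ⊆-trans; ⊥⊆; ∣p∩q∣≤∣p∣; p⊆q⇒∣p∣≤∣q∣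
        ; x∈∁p⇒x∉p; ∣∁p∣≡n∸∣p∣; p⊆q⇒∁p⊇∁q; ∣p∣≤n
        ; p∩q⊆p; p∩q⊆q; x∈p∩q⁺; x∈p∩q⁻; ∣p∩q∣≤∣q∣; q⊆p∪q; x∈p∪q⁻; x∈p∪q⁺
        ; x∈p∧x∉q⇒x∈p─q; p─q⊆p; ∣p─q∣≤∣p∣; x∈p∧x≢y⇒x∈p-y; x∈p⇒∣p-x∣<∣p∣
        ; drop-there; drop-∷-⊆; s⊆s; out⊆ )
open import Data.List using (List; []; _∷_; map; allFin)
open import Data.List.Relation.Unary.Any using (Any; here; there; satisfied)
open import Data.List.Relation.Unary.Any.Properties using (map⁺; map⁻)
open import Data.List.Membership.Propositional using (lose)
open import Data.List.Membership.Propositional.Properties using (∈-allFin)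
open import Data.Vec using (_∷_; []; lookup; tabulate; here; there)
open import Data.Vec.Properties using (lookup∘tabulate; []=⇒lookup; lookup⇒[]=)
open import Data.Product using (_×_; _,_; ∃; proj₂)
open import Data.Sum using (_⊎_; inj₁; inj₂)
open import Data.Empty using (⊥-elim)
open import Function using (_∘_; case_of_)
open import Relation.Nullary using (¬_; yes; no; contradiction)
open import Relation.Nullary.Decidable using (isYes≗does; dec-true)
open import Relation.Binary.PropositionalEquality using (_≡_; _≢_; refl; sym; trans; cong; subst)

private variable
  n : ℕ
  x y : Fin n
  p q : Subset n

∣p∣≡∣p∩q∣+∣p─q∣ : ∀ (p q : Subset n) → ∣ p ∣ ≡ ∣ p ∩ q ∣ + ∣ p ─ q ∣
∣p∣≡∣p∩q∣+∣p─q∣ []            []            = refl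
∣p∣≡∣p∩q∣+∣p─q∣ (inside  ∷ p) (inside  ∷ q) = cong suc (∣p∣≡∣p∩q∣+∣p─q∣ p q)
∣p∣≡∣p∩q∣+∣p─q∣ (inside  ∷ p) (outside ∷ q) =
  trans (cong suc (∣p∣≡∣p∩q∣+∣p─q∣ p q)) (sym (+-suc _ _))
∣p∣≡∣p∩q∣+∣p─q∣ (outside ∷ p) (inside  ∷ q) = ∣p∣≡∣p∩q∣+∣p─q∣ p q
∣p∣≡∣p∩q∣+∣p─q∣ (outside ∷ p) (outside ∷ q) = ∣p∣≡∣p∩q∣+∣p─q∣ p q

∣p∪q∣≤∣p∣+∣q∣ : ∀ (p q : Subset n) → ∣ p ∪ q ∣ ≤ ∣ p ∣ + ∣ q ∣
∣p∪q∣≤∣p∣+∣q∣ []            []            = z≤n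
∣p∪q∣≤∣p∣+∣q∣ (inside  ∷ p) (inside  ∷ q) =
  s≤s (≤-trans (∣p∪q∣≤∣p∣+∣q∣ p q) (+-monoʳ-≤ ∣ p ∣ (n≤1+n ∣ q ∣)))
∣p∪q∣≤∣p∣+∣q∣ (inside  ∷ p) (outside ∷ q) = s≤s (∣p∪q∣≤∣p∣+∣q∣ p q)
∣p∪q∣≤∣p∣+∣q∣ (outside ∷ p) (inside  ∷ q) =
  ≤-trans (s≤s (∣p∪q∣≤∣p∣+∣q∣ p q)) (≤-reflexive (sym (+-suc ∣ p ∣ ∣ q ∣)))
∣p∪q∣≤∣p∣+∣q∣ (outside ∷ p) (outside ∷ q) = ∣p∪q∣≤∣p∣+∣q∣ p q

∣⁅x⁆∪p∣≤1+∣p∣ : ∀ (x : Fin n) p → ∣ ⁅ x ⁆ ∪ p ∣ ≤ suc ∣ p ∣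
∣⁅x⁆∪p∣≤1+∣p∣ x p =
  subst (λ m → ∣ ⁅ x ⁆ ∪ p ∣ ≤ m + ∣ p ∣) (∣⁅x⁆∣≡1 x) (∣p∪q∣≤∣p∣+∣q∣ ⁅ x ⁆ p)

∣∁p∣+∣p∣≡n : ∀ (p : Subset n) → ∣ ∁ p ∣ + ∣ p ∣ ≡ n
∣∁p∣+∣p∣≡n p = trans (cong (_+ ∣ p ∣) (∣∁p∣≡n∸∣p∣ p)) (m∸n+n≡m (∣p∣≤n p))

∣p∣≤1+∣p-x∣ : ∀ (p : Subset n) x → ∣ p ∣ ≤ suc ∣ p - x ∣
∣p∣≤1+∣p-x∣ p x = begin
  ∣ p ∣                      ≡⟨ ∣p∣≡∣p∩q∣+∣p─q∣ p ⁅ x ⁆ ⟩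
  ∣ p ∩ ⁅ x ⁆ ∣ + ∣ p - x ∣  ≤⟨ +-monoˡ-≤ ∣ p - x ∣ (∣p∩q∣≤∣q∣ p ⁅ x ⁆) ⟩
  ∣ ⁅ x ⁆ ∣ + ∣ p - x ∣      ≡⟨ cong (_+ ∣ p - x ∣) (∣⁅x⁆∣≡1 x) ⟩
  suc ∣ p - x ∣              ∎
  where open ≤-Reasoning

x∈p─q⇒x∉q : ∀ (p q : Subset n) → x ∈ p ─ q → x ∉ q
x∈p─q⇒x∉q (_ ∷ p) (_ ∷ q) (there x∈p─q) = x∈p─q⇒x∉q p q x∈p─q ∘ drop-there
x∈p─q⇒x∉q (inside ∷ p) (outside ∷ q) here = λ ()

0<∣p∣⇒Nonempty : ∀ (p : Subset n) → 0 < ∣ p ∣ → Nonempty p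
0<∣p∣⇒Nonempty (inside  ∷ p) _     = zero , here
0<∣p∣⇒Nonempty (outside ∷ p) 0<∣p∣ with 0<∣p∣⇒Nonempty p 0<∣p∣
... | x , x∈p = suc x , there x∈p

2≤∣p∣⇒∃≢ : 2 ≤ ∣ p ∣ → (x : Fin n) → ∃ λ y → y ∈ p × y ≢ x
2≤∣p∣⇒∃≢ {p = p} 2≤∣p∣ x
  with 0<∣p∣⇒Nonempty (p - x) (≤-pred (≤-trans 2≤∣p∣ (∣p∣≤1+∣p-x∣ p x)))
... | y , y∈p-x = y , p─q⊆p p ⁅ x ⁆ y∈p-x , x∉⁅y⁆⇒x≢y (x∈p─q⇒x∉q p ⁅ x ⁆ y∈p-x)

p⊆q⇒∣q∣≡∣p∣+∣q─p∣ : p ⊆ q → ∣ q ∣ ≡ ∣ p ∣ + ∣ q ─ p ∣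
p⊆q⇒∣q∣≡∣p∣+∣q─p∣ {p = p} {q = q} p⊆q =
  trans (∣p∣≡∣p∩q∣+∣p─q∣ q p) (cong (λ r → ∣ r ∣ + ∣ q ─ p ∣) q∩p≡p)
  where
  q∩p≡p : q ∩ p ≡ p
  q∩p≡p = ⊆-antisym (p∩q⊆q q p) (λ x∈p → x∈p∩q⁺ (p⊆q x∈p , x∈p))

∣p∣<∣q∣⇒q─p≢∅ : p ⊆ q → ∣ p ∣ < ∣ q ∣ → Nonempty (q ─ p)
∣p∣<∣q∣⇒q─p≢∅ {p = p} {q = q} p⊆q ∣p∣<∣q∣ =
  0<∣p∣⇒Nonempty (q ─ p) (+-cancelˡ-< ∣ p ∣ 0 _ (begin-strict
  ∣ p ∣ + 0          ≡⟨ +-identityʳ ∣ p ∣ ⟩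
  ∣ p ∣              <⟨ ∣p∣<∣q∣ ⟩
  ∣ q ∣              ≡⟨ p⊆q⇒∣q∣≡∣p∣+∣q─p∣ p⊆q ⟩
  ∣ p ∣ + ∣ q ─ p ∣  ∎))
  where open ≤-Reasoning

p⊆∁q⇒∣p∩q∣≡0 : ∀ {n} {p q : Subset n} → p ⊆ ∁ q → ∣ p ∩ q ∣ ≡ 0
p⊆∁q⇒∣p∩q∣≡0 {n} {p} {q} p⊆∁q = trans (cong ∣_∣ (Empty-unique disjoint)) (∣⊥∣≡0 n)
  where
  disjoint : Empty (p ∩ q)
  disjoint (_ , x∈p∩q) = x∈∁p⇒x∉p (p⊆∁q (p∩q⊆p p q x∈p∩q)) (p∩q⊆q p q x∈p∩q)

∁q⊆p⇒∣p∩q∣+∣∁q∣≤∣p∣ : ∁ q ⊆ p → ∣ p ∩ q ∣ + ∣ ∁ q ∣ ≤ ∣ p ∣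
∁q⊆p⇒∣p∩q∣+∣∁q∣≤∣p∣ {q = q} {p = p} ∁q⊆p = begin
  ∣ p ∩ q ∣ + ∣ ∁ q ∣    ≤⟨ +-monoʳ-≤ ∣ p ∩ q ∣ (p⊆q⇒∣p∣≤∣q∣ ∁q⊆p─q) ⟩
  ∣ p ∩ q ∣ + ∣ p ─ q ∣  ≡⟨ ∣p∣≡∣p∩q∣+∣p─q∣ p q ⟨
  ∣ p ∣                  ∎
  where
  open ≤-Reasoning
  ∁q⊆p─q : ∁ q ⊆ p ─ q
  ∁q⊆p─q x∈∁q = x∈p∧x∉q⇒x∈p─q (∁q⊆p x∈∁q) (x∈∁p⇒x∉p x∈∁q)

x,y∈p⇒2≤∣p∣ : x ∈ p → y ∈ p → x ≢ y → 2 ≤ ∣ p ∣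
x,y∈p⇒2≤∣p∣ x∈p y∈p x≢y =
  ≤-trans (s≤s (≤-trans (s≤s z≤n) (x∈p⇒∣p-x∣<∣p∣ y∈p-x))) (x∈p⇒∣p-x∣<∣p∣ x∈p)
  where y∈p-x = x∈p∧x≢y⇒x∈p-y y∈p (x≢y ∘ sym)

subset-between : ∀ (S T : Subset n) {m} → S ⊆ T → ∣ S ∣ ≤ m → m ≤ ∣ T ∣ →
                 ∃ λ C → S ⊆ C × C ⊆ T × ∣ C ∣ ≡ m
subset-between []            []            _    z≤n       z≤n = [] , (λ ()) , (λ ()) , refl
subset-between (inside  ∷ S) (outside ∷ T) S⊆T _         _   = contradiction (S⊆T here) λ ()
subset-between (inside  ∷ S) (inside  ∷ T) S⊆T (s≤s S≤m) (s≤s m≤T)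
  with C , S⊆C , C⊆T , ∣C∣≡m ← subset-between S T (drop-∷-⊆ S⊆T) S≤m m≤T
  = inside ∷ C , s⊆s S⊆C , s⊆s C⊆T , cong suc ∣C∣≡m
subset-between (outside ∷ S) (outside ∷ T) S⊆T S≤m m≤T
  with C , S⊆C , C⊆T , ∣C∣≡m ← subset-between S T (drop-∷-⊆ S⊆T) S≤m m≤T
  = outside ∷ C , s⊆s S⊆C , s⊆s C⊆T , ∣C∣≡m
subset-between (outside ∷ S) (inside  ∷ T) {m} S⊆T S≤m m≤1+T with m ≤? ∣ T ∣
... | no  m≰T = inside ∷ T , S⊆T , ⊆-refl , sym (≤-antisym m≤1+T (≰⇒> m≰T))
... | yes m≤T with C , S⊆C , C⊆T , ∣C∣≡m ← subset-between S T (drop-∷-⊆ S⊆T) S≤m m≤T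
  = outside ∷ C , s⊆s S⊆C , out⊆ C⊆T , ∣C∣≡m

∃-subset-of-size : ∀ (T : Subset n) {m} → m ≤ ∣ T ∣ → ∃ λ C → C ⊆ T × ∣ C ∣ ≡ m
∃-subset-of-size {n} T {m} m≤∣T∣ =
  let C , _ , C⊆T , ∣C∣≡m = subset-between ⊥ T ⊥⊆ (subst (_≤ m) (sym (∣⊥∣≡0 n)) z≤n) m≤∣T∣
  in C , C⊆T , ∣C∣≡m

∈-tabulate⁻ : ∀ {f : Fin n → Bool} → x ∈ tabulate f → f x ≡ true
∈-tabulate⁻ {f = f} x∈ = trans (sym (lookup∘tabulate f _)) ([]=⇒lookup x∈)

∈-tabulate⁺ : ∀ {f : Fin n → Bool} → f x ≡ true → x ∈ tabulate f
∈-tabulate⁺ {x = x} {f = f} fx = lookup⇒[]= x (tabulate f) (trans (lookup∘tabulate f x) fx)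

∈-if⁺ : ∀ {X : Subset n} → x ∈ X → y ∈ p → y ∈ (if lookup X x then p else ⊥)
∈-if⁺ x∈X y∈p rewrite []=⇒lookup x∈X = y∈p

∈-if⁻ : ∀ (X : Subset n) x → y ∈ (if lookup X x then p else ⊥) → x ∈ X × y ∈ p
∈-if⁻ X x y∈ with lookup X x in X[x]
... | true  = lookup⇒[]= x X X[x] , y∈
... | false = contradiction y∈ ∉⊥

x∈⋃⁺ : ∀ {ps : List (Subset n)} → Any (x ∈_) ps → x ∈ ⋃ ps
x∈⋃⁺ (here  x∈p)  = x∈p∪q⁺ (inj₁ x∈p)
x∈⋃⁺ (there x∈ps) = x∈p∪q⁺ (inj₂ (x∈⋃⁺ x∈ps))

x∈⋃⁻ : ∀ (ps : List (Subset n)) → x ∈ ⋃ ps → Any (x ∈_) ps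
x∈⋃⁻ []       x∈ = contradiction x∈ ∉⊥
x∈⋃⁻ (p ∷ ps) x∈ with x∈p∪q⁻ p (⋃ ps) x∈
... | inj₁ x∈p  = here x∈p
... | inj₂ x∈ps = there (x∈⋃⁻ ps x∈ps)

module Neighbourhoods {n} (G : Graph n) where

  x∈N[x] : ∀ x → x ∈ N[ G ∣ x ]
  x∈N[x] x =
    ∈-tabulate⁺ (cong (_∨ adj G x x) (trans (isYes≗does (x ≟ x)) (dec-true (x ≟ x) refl)))

  adj⇒∈N : adj G x y ≡ true → y ∈ N[ G ∣ x ]
  adj⇒∈N xy = ∈-tabulate⁺ (trans (cong (_ ∨_) xy) (∨-zeroʳ _))

  ∈N⇒≡⊎adj : y ∈ N[ G ∣ x ] → x ≡ y ⊎ adj G x y ≡ true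
  ∈N⇒≡⊎adj {y = y} {x = x} y∈ with x ≟ y | ∈-tabulate⁻ y∈
  ... | yes x≡y | _  = inj₁ x≡y
  ... | no  _   | xy = inj₂ xy

  ∈NS⁺ : ∀ {X} → x ∈ X → y ∈ N[ G ∣ x ] → y ∈ NS[ G ∣ X ]
  ∈NS⁺ {x = x} x∈X y∈ = x∈⋃⁺ (map⁺ (lose (∈-allFin x) (∈-if⁺ x∈X y∈)))

  ∈NS⁻ : ∀ {X} → y ∈ NS[ G ∣ X ] → ∃ λ x → x ∈ X × y ∈ N[ G ∣ x ]
  ∈NS⁻ {X = X} y∈ with x , y∈x ← satisfied (map⁻ (x∈⋃⁻ (map _ (allFin n)) y∈)) =
    x , ∈-if⁻ X x y∈x

  NS-mono : ∀ {X Y} → X ⊆ Y → NS[ G ∣ X ] ⊆ NS[ G ∣ Y ]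
  NS-mono X⊆Y y∈ with x , x∈X , y∈x ← ∈NS⁻ y∈ = ∈NS⁺ (X⊆Y x∈X) y∈x

module IdentifyingSet {n} (G : Graph n) (ℓ : ℕ) (C : Subset n) (C-id : Identifying G ℓ C) where
  open Neighbourhoods G

  ¬mutual-trace-inclusion : ∀ {X Y} → ∣ X ∣ ≤ ℓ → ∣ Y ∣ ≤ ℓ → x ∈ X → x ∉ Y →
    ¬ (NS[ G ∣ X ] ∩ C ⊆ NS[ G ∣ Y ] × NS[ G ∣ Y ] ∩ C ⊆ NS[ G ∣ X ])
  ¬mutual-trace-inclusion {x = x} {X} {Y} ∣X∣≤ℓ ∣Y∣≤ℓ x∈X x∉Y (X⊆Y , Y⊆X) =
    C-id X Y ∣X∣≤ℓ ∣Y∣≤ℓ (λ X≡Y → x∉Y (subst (x ∈_) X≡Y x∈X))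
      (⊆-antisym (trace-⊆ {X} {Y} X⊆Y) (trace-⊆ {Y} {X} Y⊆X))
    where
    trace-⊆ : ∀ {A B} → NS[ G ∣ A ] ∩ C ⊆ NS[ G ∣ B ] → NS[ G ∣ A ] ∩ C ⊆ NS[ G ∣ B ] ∩ C
    trace-⊆ {A} A⊆B c∈ = x∈p∩q⁺ (A⊆B c∈ , p∩q⊆q NS[ G ∣ A ] C c∈)

  ¬both-dominating : ∀ {X Y} → ∣ X ∣ ≤ ℓ → ∣ Y ∣ ≤ ℓ → x ∈ X → x ∉ Y →
    C ⊆ NS[ G ∣ X ] → ¬ (C ⊆ NS[ G ∣ Y ])
  ¬both-dominating {X = X} {Y} ∣X∣≤ℓ ∣Y∣≤ℓ x∈X x∉Y C⊆X C⊆Y =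
    ¬mutual-trace-inclusion {X = X} {Y} ∣X∣≤ℓ ∣Y∣≤ℓ x∈X x∉Y
      ((λ c∈ → C⊆Y (p∩q⊆q NS[ G ∣ X ] C c∈)) , (λ c∈ → C⊆X (p∩q⊆q NS[ G ∣ Y ] C c∈)))

  ¬⊆N : 2 ≤ ℓ → y ≢ x → ¬ (C ⊆ N[ G ∣ x ])
  ¬⊆N {y = y} {x} 2≤ℓ y≢x C⊆N[x] =
    ¬both-dominating {X = ⁅ y ⁆ ∪ ⁅ x ⁆} {Y = ⁅ x ⁆} ∣X∣≤ℓ ∣Y∣≤ℓ
      (x∈p∪q⁺ (inj₁ (x∈⁅x⁆ y))) (x≢y⇒x∉⁅y⁆ y≢x)
      (λ c∈C → ∈NS⁺ {X = ⁅ y ⁆ ∪ ⁅ x ⁆} (x∈p∪q⁺ (inj₂ (x∈⁅x⁆ x))) (C⊆N[x] c∈C))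
      (λ c∈C → ∈NS⁺ (x∈⁅x⁆ x) (C⊆N[x] c∈C))
    where
    ∣Y∣≤ℓ : ∣ ⁅ x ⁆ ∣ ≤ ℓ
    ∣Y∣≤ℓ = subst (_≤ ℓ) (sym (∣⁅x⁆∣≡1 x)) (≤-trans (n≤1+n 1) 2≤ℓ)
    ∣X∣≤ℓ : ∣ ⁅ y ⁆ ∪ ⁅ x ⁆ ∣ ≤ ℓ
    ∣X∣≤ℓ = ≤-trans (∣⁅x⁆∪p∣≤1+∣p∣ y ⁅ x ⁆) (subst (λ m → suc m ≤ ℓ) (sym (∣⁅x⁆∣≡1 x)) 2≤ℓ)

  -- A vertex of C dominated by x but not by y lies in A and dominates itself.
  private-part-bound : x ≢ y → x ∉ C ∩ (N[ G ∣ x ] ─ N[ G ∣ y ]) →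
    ℓ ≤ suc ∣ C ∩ (N[ G ∣ x ] ─ N[ G ∣ y ]) ∣
  private-part-bound {x = x} {y} x≢y x∉A = ≮⇒≥ λ 2+∣A∣≤ℓ →
    ¬mutual-trace-inclusion {X = X} {Y} (∣X∣≤ℓ 2+∣A∣≤ℓ) (∣Y∣≤ℓ 2+∣A∣≤ℓ) x∈X x∉Y
      (X-trace⊆ , λ c∈ → NS-mono Y⊆X (p∩q⊆p NS[ G ∣ Y ] C c∈))
    where
    A = C ∩ (N[ G ∣ x ] ─ N[ G ∣ y ])
    Y = ⁅ y ⁆ ∪ A
    X = ⁅ x ⁆ ∪ Y
    Y⊆X : Y ⊆ X
    Y⊆X = q⊆p∪q ⁅ x ⁆ Y
    ∣Y∣≤ℓ : suc (suc ∣ A ∣) ≤ ℓ → ∣ Y ∣ ≤ ℓ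
    ∣Y∣≤ℓ 2+∣A∣≤ℓ = ≤-trans (∣⁅x⁆∪p∣≤1+∣p∣ y A) (≤-trans (n≤1+n _) 2+∣A∣≤ℓ)
    ∣X∣≤ℓ : suc (suc ∣ A ∣) ≤ ℓ → ∣ X ∣ ≤ ℓ
    ∣X∣≤ℓ 2+∣A∣≤ℓ = ≤-trans (∣⁅x⁆∪p∣≤1+∣p∣ x Y) (≤-trans (s≤s (∣⁅x⁆∪p∣≤1+∣p∣ y A)) 2+∣A∣≤ℓ)
    x∈X : x ∈ X
    x∈X = x∈p∪q⁺ (inj₁ (x∈⁅x⁆ x))
    x∉Y : x ∉ Y
    x∉Y x∈Y with x∈p∪q⁻ ⁅ y ⁆ A x∈Y
    ... | inj₁ x∈⁅y⁆ = x≢y (x∈⁅y⁆⇒x≡y y x∈⁅y⁆)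
    ... | inj₂ x∈A   = x∉A x∈A
    X-trace⊆ : NS[ G ∣ X ] ∩ C ⊆ NS[ G ∣ Y ]
    X-trace⊆ {c} c∈ with x∈p∩q⁻ NS[ G ∣ X ] C c∈
    ... | c∈NS , c∈C with ∈NS⁻ c∈NS
    ...   | u , u∈X , c∈N[u] with x∈p∪q⁻ ⁅ x ⁆ Y u∈X
    ...     | inj₂ u∈Y = ∈NS⁺ u∈Y c∈N[u]
    ...     | inj₁ u∈⁅x⁆ with refl ← x∈⁅y⁆⇒x≡y x u∈⁅x⁆ with c ∈? N[ G ∣ y ]
    ...       | yes c∈N[y] = ∈NS⁺ {X = Y} (x∈p∪q⁺ (inj₁ (x∈⁅x⁆ y))) c∈N[y]
    ...       | no  c∉N[y] =
      ∈NS⁺ {X = Y} (x∈p∪q⁺ (inj₂ (x∈p∩q⁺ (c∈C , x∈p∧x∉q⇒x∈p─q c∈N[u] c∉N[y])))) (x∈N[x] c)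

  -- The neighbour z of a takes over the role of a in dominating C.
  outside-part-bound : ∀ {x a z} → a ∈ C ─ N[ G ∣ x ] → adj G a z ≡ true →
    ℓ ≤ ∣ C ─ N[ G ∣ x ] ∣
  outside-part-bound {x} {a} {z} a∈A az = ≮⇒≥ λ ∣A∣<ℓ →
    ¬both-dominating {X = X} {Y} (∣X∣≤ℓ ∣A∣<ℓ) (∣Y∣≤ℓ ∣A∣<ℓ) (x∈p∪q⁺ (inj₂ a∈A)) a∉Y
      C⊆NS[X] C⊆NS[Y]
    where
    A = C ─ N[ G ∣ x ]
    X = ⁅ x ⁆ ∪ A
    Y = ⁅ x ⁆ ∪ ⁅ z ⁆ ∪ (A - a)
    ∣X∣≤ℓ : ∣ A ∣ < ℓ → ∣ X ∣ ≤ ℓ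
    ∣X∣≤ℓ = ≤-trans (∣⁅x⁆∪p∣≤1+∣p∣ x A)
    ∣Y∣≤ℓ : ∣ A ∣ < ℓ → ∣ Y ∣ ≤ ℓ
    ∣Y∣≤ℓ ∣A∣<ℓ = begin
      ∣ Y ∣                        ≤⟨ ∣⁅x⁆∪p∣≤1+∣p∣ x _ ⟩
      suc ∣ ⁅ z ⁆ ∪ (A - a) ∣      ≤⟨ s≤s (∣⁅x⁆∪p∣≤1+∣p∣ z _) ⟩
      suc (suc ∣ A - a ∣)          ≤⟨ s≤s (x∈p⇒∣p-x∣<∣p∣ a∈A) ⟩
      suc ∣ A ∣                    ≤⟨ ∣A∣<ℓ ⟩
      ℓ                            ∎
      where open ≤-Reasoning
    a∉N[x] : a ∉ N[ G ∣ x ]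
    a∉N[x] = x∈p─q⇒x∉q C N[ G ∣ x ] a∈A
    a∉Y : a ∉ Y
    a∉Y a∈Y with x∈p∪q⁻ ⁅ x ⁆ _ a∈Y
    ... | inj₁ a∈⁅x⁆ with refl ← x∈⁅y⁆⇒x≡y x a∈⁅x⁆ = a∉N[x] (x∈N[x] a)
    ... | inj₂ a∈Y′ with x∈p∪q⁻ ⁅ z ⁆ (A - a) a∈Y′
    ...   | inj₁ a∈⁅z⁆ with refl ← x∈⁅y⁆⇒x≡y z a∈⁅z⁆ =
      contradiction (trans (sym az) (irrefl G a)) λ ()
    ...   | inj₂ a∈A-a = x∈p─q⇒x∉q A ⁅ a ⁆ a∈A-a (x∈⁅x⁆ a)
    C⊆NS[X] : C ⊆ NS[ G ∣ X ]
    C⊆NS[X] {c} c∈C with c ∈? N[ G ∣ x ]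
    ... | yes c∈N[x] = ∈NS⁺ {X = X} (x∈p∪q⁺ (inj₁ (x∈⁅x⁆ x))) c∈N[x]
    ... | no  c∉N[x] = ∈NS⁺ {X = X} (x∈p∪q⁺ (inj₂ (x∈p∧x∉q⇒x∈p─q c∈C c∉N[x]))) (x∈N[x] c)
    C⊆NS[Y] : C ⊆ NS[ G ∣ Y ]
    C⊆NS[Y] {c} c∈C with c ∈? N[ G ∣ x ] | c ≟ a
    ... | yes c∈N[x] | _        = ∈NS⁺ {X = Y} (x∈p∪q⁺ (inj₁ (x∈⁅x⁆ x))) c∈N[x]
    ... | no  _      | yes refl =
      ∈NS⁺ {X = Y} (x∈p∪q⁺ (inj₂ (x∈p∪q⁺ (inj₁ (x∈⁅x⁆ z))))) (adj⇒∈N (trans (Graph.sym G z a) az))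
    ... | no  c∉N[x] | no  c≢a  =
      ∈NS⁺ {X = Y} (x∈p∪q⁺ (inj₂ (x∈p∪q⁺ (inj₂ (x∈p∧x≢y⇒x∈p-y (x∈p∧x∉q⇒x∈p─q c∈C c∉N[x]) c≢a)))))
        (x∈N[x] c)

module InGrProperties {n k ℓ : ℕ} {G : Graph n}
  (1≤k : 1 ≤ k) (k<n : k < n) (2≤ℓ : 2 ≤ ℓ) (G∈Gr : InGr G k ℓ) where
  open Neighbourhoods G
  open ≤-Reasoning

  module KSubset {C} (∣C∣≡k : ∣ C ∣ ≡ k) = IdentifyingSet G ℓ C (G∈Gr C ∣C∣≡k)

  1≤n∸k : 1 ≤ n ∸ k
  1≤n∸k = m<n⇒0<n∸m k<n

  n∸k+k≡n : n ∸ k + k ≡ n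
  n∸k+k≡n = m∸n+n≡m (<⇒≤ k<n)

  k≤∣⊤∣ : k ≤ ∣ ⊤ {n} ∣
  k≤∣⊤∣ = subst (k ≤_) (sym (∣⊤∣≡n n)) (<⇒≤ k<n)

  2≤∣⊤∣ : 2 ≤ ∣ ⊤ {n} ∣
  2≤∣⊤∣ = subst (2 ≤_) (sym (∣⊤∣≡n n)) (≤-trans (s≤s 1≤k) k<n)

  another-vertex : (x : Fin n) → ∃ λ y → y ≢ x
  another-vertex x with y , _ , y≢x ← 2≤∣p∣⇒∃≢ {p = ⊤} 2≤∣⊤∣ x = y , y≢x

  -- C ⊆ T keeps x out of C ∩ D; among such k-sets one meeting D as little as possible is used.
  private-neighbourhood-size : x ≢ y → n ∸ k + ℓ ≤ suc ∣ N[ G ∣ x ] ─ N[ G ∣ y ] ∣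
  private-neighbourhood-size {x = x} {y} x≢y = case k ≤? ∣ ∁ D ∣ of λ where
      (yes k≤∣∁D∣) →
        let C , C⊆∁D , ∣C∣≡k = ∃-subset-of-size (∁ D) k≤∣∁D∣
        in ⊥-elim (<⇒≱ 2≤ℓ (subst (λ m → ℓ ≤ suc m) (p⊆∁q⇒∣p∩q∣≡0 C⊆∁D)
                                  (ℓ≤1+∣C∩D∣ (⊆-trans C⊆∁D ∁D⊆T) ∣C∣≡k)))
      (no k≰∣∁D∣) →
        let C , ∁D⊆C , C⊆T , ∣C∣≡k = subset-between (∁ D) T ∁D⊆T (<⇒≤ (≰⇒> k≰∣∁D∣)) k≤∣T∣
        in counting (ℓ≤1+∣C∩D∣ C⊆T ∣C∣≡k)
                    (≤-trans (∁q⊆p⇒∣p∩q∣+∣∁q∣≤∣p∣ {q = D} ∁D⊆C) (≤-reflexive ∣C∣≡k))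
    where
    D = N[ G ∣ x ] ─ N[ G ∣ y ]
    T = ∁ (⁅ x ⁆ ∩ D)
    k≤∣T∣ : k ≤ ∣ T ∣
    k≤∣T∣ = ≤-pred (begin
      suc k                  ≤⟨ k<n ⟩
      n                      ≡⟨ ∣∁p∣+∣p∣≡n (⁅ x ⁆ ∩ D) ⟨
      ∣ T ∣ + ∣ ⁅ x ⁆ ∩ D ∣  ≤⟨ +-monoʳ-≤ ∣ T ∣ (∣p∩q∣≤∣p∣ ⁅ x ⁆ D) ⟩
      ∣ T ∣ + ∣ ⁅ x ⁆ ∣      ≡⟨ cong (∣ T ∣ +_) (∣⁅x⁆∣≡1 x) ⟩
      ∣ T ∣ + 1              ≡⟨ +-comm ∣ T ∣ 1 ⟩
      suc ∣ T ∣              ∎)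
    ∁D⊆T : ∁ D ⊆ T
    ∁D⊆T = p⊆q⇒∁p⊇∁q (p∩q⊆q ⁅ x ⁆ D)
    ℓ≤1+∣C∩D∣ : ∀ {C} → C ⊆ T → ∣ C ∣ ≡ k → ℓ ≤ suc ∣ C ∩ D ∣
    ℓ≤1+∣C∩D∣ {C} C⊆T ∣C∣≡k = KSubset.private-part-bound ∣C∣≡k x≢y λ x∈C∩D →
      x∈∁p⇒x∉p {p = ⁅ x ⁆ ∩ D} (C⊆T (p∩q⊆p C D x∈C∩D)) (x∈p∩q⁺ (x∈⁅x⁆ x , p∩q⊆q C D x∈C∩D))
    counting : ∀ {a} → ℓ ≤ suc a → a + ∣ ∁ D ∣ ≤ k → n ∸ k + ℓ ≤ suc ∣ D ∣
    counting {a} ℓ≤1+a a+∣∁D∣≤k = +-cancelʳ-≤ ∣ ∁ D ∣ _ _ (begin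
      n ∸ k + ℓ + ∣ ∁ D ∣            ≤⟨ +-monoˡ-≤ ∣ ∁ D ∣ (+-monoʳ-≤ (n ∸ k) ℓ≤1+a) ⟩
      n ∸ k + suc a + ∣ ∁ D ∣        ≡⟨ cong (_+ ∣ ∁ D ∣) (+-suc (n ∸ k) a) ⟩
      suc (n ∸ k + a + ∣ ∁ D ∣)      ≡⟨ cong suc (+-assoc (n ∸ k) a ∣ ∁ D ∣) ⟩
      suc (n ∸ k + (a + ∣ ∁ D ∣))    ≤⟨ s≤s (+-monoʳ-≤ (n ∸ k) a+∣∁D∣≤k) ⟩
      suc (n ∸ k + k)                ≡⟨ cong suc (trans n∸k+k≡n (sym (∣∁p∣+∣p∣≡n D))) ⟩
      suc (∣ ∁ D ∣ + ∣ D ∣)          ≡⟨ cong suc (+-comm ∣ ∁ D ∣ ∣ D ∣) ⟩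
      suc ∣ D ∣ + ∣ ∁ D ∣            ∎)

  2≤∣N∣ : ∀ x → 2 ≤ ∣ N[ G ∣ x ] ∣
  2≤∣N∣ x with y , y≢x ← another-vertex x = ≤-pred (begin
    3                                    ≤⟨ s≤s 2≤ℓ ⟩
    1 + ℓ                                ≤⟨ +-monoˡ-≤ ℓ 1≤n∸k ⟩
    n ∸ k + ℓ                            ≤⟨ private-neighbourhood-size (y≢x ∘ sym) ⟩
    suc ∣ N[ G ∣ x ] ─ N[ G ∣ y ] ∣      ≤⟨ s≤s (∣p─q∣≤∣p∣ N[ G ∣ x ] N[ G ∣ y ]) ⟩
    suc ∣ N[ G ∣ x ] ∣                   ∎)

  ∃-neighbour : ∀ x → ∃ λ z → adj G x z ≡ true
  ∃-neighbour x with z , z∈N[x] , z≢x ← 2≤∣p∣⇒∃≢ (2≤∣N∣ x) x with ∈N⇒≡⊎adj z∈N[x]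
  ... | inj₁ x≡z = contradiction (sym x≡z) z≢x
  ... | inj₂ xz  = z , xz

  degree-lower : ∀ x → n ∸ k + ℓ + 1 ≤ ∣ N[ G ∣ x ] ∣
  degree-lower x with z , xz ← ∃-neighbour x = begin
    n ∸ k + ℓ + 1                  ≤⟨ +-monoˡ-≤ 1 (private-neighbourhood-size x≢z) ⟩
    suc ∣ D ∣ + 1                  ≡⟨ +-comm (suc ∣ D ∣) 1 ⟩
    2 + ∣ D ∣                      ≤⟨ +-monoˡ-≤ ∣ D ∣ 2≤∣I∣ ⟩
    ∣ I ∣ + ∣ D ∣                  ≡⟨ ∣p∣≡∣p∩q∣+∣p─q∣ N[ G ∣ x ] N[ G ∣ z ] ⟨
    ∣ N[ G ∣ x ] ∣                 ∎
    where
    I = N[ G ∣ x ] ∩ N[ G ∣ z ]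
    D = N[ G ∣ x ] ─ N[ G ∣ z ]
    x≢z : x ≢ z
    x≢z refl = contradiction (trans (sym xz) (irrefl G x)) λ ()
    2≤∣I∣ : 2 ≤ ∣ I ∣
    2≤∣I∣ = x,y∈p⇒2≤∣p∣ (x∈p∩q⁺ (x∈N[x] x , adj⇒∈N (trans (Graph.sym G z x) xz)))
                        (x∈p∩q⁺ (adj⇒∈N xz , x∈N[x] z)) x≢z

  degree-upper : ∀ x → ∣ N[ G ∣ x ] ∣ + ℓ ≤ k
  degree-upper x = case ∣ N[ G ∣ x ] ∣ <? k of λ where
      (no ∣N∣≮k) →
        let C , C⊆N , ∣C∣≡k = ∃-subset-of-size N[ G ∣ x ] (≮⇒≥ ∣N∣≮k)
        in ⊥-elim (KSubset.¬⊆N ∣C∣≡k 2≤ℓ (proj₂ (another-vertex x)) C⊆N)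
      (yes ∣N∣<k) →
        let C , N⊆C , _ , ∣C∣≡k = subset-between N[ G ∣ x ] ⊤ ⊆⊤ (<⇒≤ ∣N∣<k) k≤∣⊤∣
            a , a∈C─N = ∣p∣<∣q∣⇒q─p≢∅ N⊆C (subst (∣ N[ G ∣ x ] ∣ <_) (sym ∣C∣≡k) ∣N∣<k)
            z , az = ∃-neighbour a
        in begin
          ∣ N[ G ∣ x ] ∣ + ℓ
            ≤⟨ +-monoʳ-≤ _ (KSubset.outside-part-bound ∣C∣≡k a∈C─N az) ⟩
          ∣ N[ G ∣ x ] ∣ + ∣ C ─ N[ G ∣ x ] ∣  ≡⟨ p⊆q⇒∣q∣≡∣p∣+∣q─p∣ N⊆C ⟨
          ∣ C ∣                                ≡⟨ ∣C∣≡k ⟩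
          k                                    ∎

  common-neighbourhood-size : ∀ x y → x ≢ y → ∣ N[ G ∣ x ] ∩ N[ G ∣ y ] ∣ + 2 * ℓ ≤ k + 1
  common-neighbourhood-size x y x≢y = begin
    ∣ I ∣ + 2 * ℓ               ≡⟨ double-right ∣ I ∣ ℓ ⟩
    ∣ I ∣ + ℓ + ℓ               ≤⟨ +-monoˡ-≤ ℓ (+-monoʳ-≤ ∣ I ∣ ℓ≤1+∣D∣) ⟩
    ∣ I ∣ + suc ∣ D ∣ + ℓ       ≡⟨ suc-out ∣ I ∣ ∣ D ∣ ℓ ⟩
    ∣ I ∣ + ∣ D ∣ + ℓ + 1       ≡⟨ cong (λ m → m + ℓ + 1) (∣p∣≡∣p∩q∣+∣p─q∣ N[ G ∣ x ] N[ G ∣ y ]) ⟨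
    ∣ N[ G ∣ x ] ∣ + ℓ + 1      ≤⟨ +-monoˡ-≤ 1 (degree-upper x) ⟩
    k + 1                       ∎
    where
    I = N[ G ∣ x ] ∩ N[ G ∣ y ]
    D = N[ G ∣ x ] ─ N[ G ∣ y ]
    ℓ≤1+∣D∣ : ℓ ≤ suc ∣ D ∣
    ℓ≤1+∣D∣ = ≤-trans (m≤n+m ℓ (n ∸ k)) (private-neighbourhood-size x≢y)
    double-right : ∀ i m → i + 2 * m ≡ i + m + m
    double-right = solve-∀
    suc-out : ∀ i d m → i + suc d + m ≡ i + d + m + 1
    suc-out = solve-∀

  n+2ℓ+1≤2k : n + 2 * ℓ + 1 ≤ 2 * k
  n+2ℓ+1≤2k = begin
    n + 2 * ℓ + 1                 ≡⟨ cong (λ m → m + 2 * ℓ + 1) n∸k+k≡n ⟨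
    n ∸ k + k + 2 * ℓ + 1         ≡⟨ regroup (n ∸ k) k ℓ ⟩
    n ∸ k + ℓ + 1 + ℓ + k         ≤⟨ +-monoˡ-≤ k (+-monoˡ-≤ ℓ (degree-lower v)) ⟩
    ∣ N[ G ∣ v ] ∣ + ℓ + k        ≤⟨ +-monoˡ-≤ k (degree-upper v) ⟩
    k + k                         ≡⟨ cong (k +_) (+-identityʳ k) ⟨
    2 * k                         ∎
    where
    v : Fin n
    v = fromℕ< (≤-trans (s≤s z≤n) k<n)
    regroup : ∀ e k ℓ → e + k + 2 * ℓ + 1 ≡ e + ℓ + 1 + ℓ + k
    regroup = solve-∀

  2ℓ+2≤k : 2 * ℓ + 2 ≤ k
  2ℓ+2≤k = +-cancelˡ-≤ k _ _ (begin
    k + (2 * ℓ + 2)               ≡⟨ regroup k ℓ ⟩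
    suc k + 2 * ℓ + 1             ≤⟨ +-monoˡ-≤ 1 (+-monoˡ-≤ (2 * ℓ) k<n) ⟩
    n + 2 * ℓ + 1                 ≤⟨ n+2ℓ+1≤2k ⟩
    2 * k                         ≡⟨ cong (k +_) (+-identityʳ k) ⟩
    k + k                         ∎)
    where
    regroup : ∀ k ℓ → k + (2 * ℓ + 2) ≡ suc k + 2 * ℓ + 1
    regroup = solve-∀

theorem34 : (n k ℓ : ℕ) → (G : Graph n) → 1 ≤ k → 1 ≤ ℓ → k < n → 2 ≤ ℓ →
    InGr G k ℓ →
    ((x : Fin n) →
      (ℓ + 1 < n ∸ k + ℓ + 1) × (n ∸ k + ℓ + 1 ≤ ∣ N[ G ∣ x ] ∣) × (∣ N[ G ∣ x ] ∣ + ℓ ≤ k))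
    × ((x y : Fin n) → x ≢ y → ∣ N[ G ∣ x ] ∩ N[ G ∣ y ] ∣ + 2 * ℓ ≤ k + 1)
    × (n + 2 * ℓ + 1 ≤ 2 * k)
    × (2 * ℓ + 2 ≤ k)
theorem34 n k ℓ G 1≤k _ k<n 2≤ℓ G∈Gr =
  (λ x → +-monoˡ-≤ 1 (+-monoˡ-≤ ℓ 1≤n∸k) , degree-lower x , degree-upper x) ,
  common-neighbourhood-size , n+2ℓ+1≤2k , 2ℓ+2≤k
  where open InGrProperties {G = G} 1≤k k<n 2≤ℓ G∈Gr
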